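{- For all suspension combinations $T, T'$, if $T\to_a T'$ then $\sigma(T)\to_l\sigma(T')$.
   Context: Syntax. Fix a ring of scalars; $\alpha,\beta$ range over it. Terms: $M,N,L ::= V \mid MN \mid \alpha.M \mid M+N$; values $V,W ::= B \mid 0 \mid \alpha.V \mid V+W$; base values $B ::= x \mid \lambda x.M$. Terms are taken up to $\alpha$-conversion. Rewrite rules. $(A)$: $(M+N)L \to ML+NL$; $(\alpha.M)N \to \alpha.(MN)$; $(0)M \to 0$. $(\xi_{\lambda_{lin}})$: if $M\to M'$ then $VM \to VM'$, $V$ a value. $(A_l)$: $(M+N)V \to MV+NV$; $(\alpha.M)V \to \alpha.(MV)$; $(0)V \to 0$, $V$ a value. $(A_r)$: $B(M+N)\to BM+BN$; $B(\alpha.M)\to \alpha.(BM)$; $B(0)\to 0$, $B$ a base value. $(L)$: $M+(N+L)\to(M+N)+L$; $(M+N)+L\to M+(N+L)$; $M+N\to N+M$; $\alpha.M+\beta.M\to(\alpha+\beta).M$; $\alpha.M+M\to(\alpha+1).M$; $M+M\to(1+1).M$; $\alpha.(\beta.M)\to(\alpha\beta).M$; $\alpha.(M+N)\to\alpha.M+\alpha.N$; $1.M\to M$; $0.M\to 0$; $\alpha.0\to 0$; $0+M\to M$. $(\xi)$: if $M\to M'$ then $MN\to M'N$, $M+N\to M'+N$, $N+M\to N+M'$, $\alpha.M\to\alpha.M'$. $\to_a$ is the relation generated by $A\cup L\cup\xi$ and $\to_l$ the relation generated by $A_l\cup A_r\cup L\cup\xi\cup\xi_{\lambda_{lin}}$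 (context rules applying to the relation being defined). CPS grammar. Base computations $C ::= KB \mid B_1B_2K \mid TK$; computation combinations $D ::= C \mid 0 \mid \alpha.D \mid D_1+D_2$; base suspensions $S ::= \lambda k.C$; suspension combinations $T ::= S \mid 0\mid \alpha.T \mid T_1+T_2$; continuations $K ::= k \mid \lambda b.BbK \mid \lambda b_1.T(\lambda b_2.b_1b_2K)$; CPS-values $B ::= x \mid \lambda x.S$. Here $k,b,b_1,b_2$ are reserved variables distinct from ordinary variables $x$; $k$ occurs only as the continuation $k$ and as the binder in $\lambda k.C$; $b,b_1,b_2$ occur only where displayed. Inverse translation: $\overline{KB}=\underline{K}[\psi(B)]$; $\overline{B_1B_2K}=\underline{K}[\psi(B_1)\psi(B_2)]$; $\overline{TK}=\underline{K}[\sigma(T)]$; $\overline{0}=0$; $\overline{\alpha.D}=\alpha.\overline{D}$; $\overline{D_1+D_2}=\overline{D_1}+\overline{D_2}$; $\sigma(\lambda k.C)=\overline{C}$; $\sigma(0)=0$; $\sigma(\alpha.T)=\alpha.\sigma(T)$; $\sigma(T_1+T_2)=\sigma(T_1)+\sigma(T_2)$; $\psi(x)=x$; $\psi(\lambda x.S)=\lambda x.\sigma(S)$; for a term $M$: $\underline{k}[M]=M$; $\underline{\lambda b.BbK}[M]=\underline{K}[\psi(B)M]$; $\underline{\lambda b_1.T(\lambda b_2.b_1b_2K)}[M]=\underline{K}[M\,\sigma(T)]$. -}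

module Defs where

open import Level using (_⊔_)
open import Data.Nat using (ℕ; zero; suc)
open import Data.List using (List; []; _∷_)
open import Algebra.Bundles using (Ring)

module Lang {c ℓ} (R : Ring c ℓ) where
  open Ring R using (Carrier; 0#; 1#) renaming (_+_ to _+ᴿ_; _*_ to _*ᴿ_)

  -- Terms (de Bruijn indices, so terms are identified up to
  -- alpha-conversion).  M,N,L ::= x | λx.M | MN | 0 | α.M | M+N
  data Term : Set c where
    var  : ℕ → Term
    lam  : Term → Term
    app  : Term → Term → Term
    zer  : Term
    smul : Carrier → Term → Term
    add  : Term → Term → Term

  data IsBase : Term → Set c where
    base-var : ∀ {x} → IsBase (var x)
    base-lam : ∀ {M} → IsBase (lam M)

  data IsValue : Term → Set c where
    val-base : ∀ {B} → IsBase B → IsValue B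
    val-zer  : IsValue zer
    val-smul : ∀ {a V} → IsValue V → IsValue (smul a V)
    val-add  : ∀ {V W} → IsValue V → IsValue W → IsValue (add V W)

  data _→A_ : Term → Term → Set c where
    A-add  : ∀ {M N L} → app (add M N) L →A add (app M L) (app N L)
    A-smul : ∀ {a M N} → app (smul a M) N →A smul a (app M N)
    A-zer  : ∀ {M} → app zer M →A zer

  data _→L_ : Term → Term → Set c where
    L-assocˡ : ∀ {M N L} → add M (add N L) →L add (add M N) L
    L-assocʳ : ∀ {M N L} → add (add M N) L →L add M (add N L)
    L-comm   : ∀ {M N} → add M N →L add N M
    L-fact   : ∀ {a b M} → add (smul a M) (smul b M) →L smul (a +ᴿ b) M
    L-fact¹  : ∀ {a M} → add (smul a M) M →L smul (a +ᴿ 1#) M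
    L-fact²  : ∀ {M} → add M M →L smul (1# +ᴿ 1#) M
    L-smul   : ∀ {a b M} → smul a (smul b M) →L smul (a *ᴿ b) M
    L-dist   : ∀ {a M N} → smul a (add M N) →L add (smul a M) (smul a N)
    L-one    : ∀ {M} → smul 1# M →L M
    L-zeroˢ  : ∀ {M} → smul 0# M →L zer
    L-zeroᵗ  : ∀ {a} → smul a zer →L zer
    L-zeroᵃ  : ∀ {M} → add zer M →L M

  data _→a_ : Term → Term → Set c where
    a-A      : ∀ {M N} → M →A N → M →a N
    a-L      : ∀ {M N} → M →L N → M →a N
    a-ξ-app  : ∀ {M M' N} → M →a M' → app M N →a app M' N
    a-ξ-addˡ : ∀ {M M' N} → M →a M' → add M N →a add M' N
    a-ξ-addʳ : ∀ {M M' N} → M →a M' → add N M →a add N M'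
    a-ξ-smul : ∀ {a M M'} → M →a M' → smul a M →a smul a M'

  data _→l_ : Term → Term → Set c where
    Al-add   : ∀ {M N V} → IsValue V → app (add M N) V →l add (app M V) (app N V)
    Al-smul  : ∀ {a M V} → IsValue V → app (smul a M) V →l smul a (app M V)
    Al-zer   : ∀ {V} → IsValue V → app zer V →l zer
    Ar-add   : ∀ {B M N} → IsBase B → app B (add M N) →l add (app B M) (app B N)
    Ar-smul  : ∀ {B a M} → IsBase B → app B (smul a M) →l smul a (app B M)
    Ar-zer   : ∀ {B} → IsBase B → app B zer →l zer
    l-L      : ∀ {M N} → M →L N → M →l N
    l-ξ-app  : ∀ {M M' N} → M →l M' → app M N →l app M' N
    l-ξ-addˡ : ∀ {M M' N} → M →l M' → add M N →l add M' N
    l-ξ-addʳ : ∀ {M M' N} → M →l M' → add N M →l add N M'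
    l-ξ-smul : ∀ {a M M'} → M →l M' → smul a M →l smul a M'
    l-ξ-lin  : ∀ {V M M'} → IsValue V → M →l M' → app V M →l app V M'

  -- Ordinary variables x are de Bruijn
  -- indices counting only ordinary binders λx; the reserved variables
  -- k, b, b₁, b₂ occur only in the displayed positions and are therefore
  -- implicit in the constructors.
  mutual
    data CVal : Set c where
      cvar : ℕ → CVal
      clam : Susp → CVal

    -- base suspensions  S ::= λk.C
    data Susp : Set c where
      slam : BComp → Susp

    data SComb : Set c where
      sus   : Susp → SComb
      szer  : SComb
      ssmul : Carrier → SComb → SComb
      sadd  : SComb → SComb → SComb

    -- base computations  C ::= K B | B₁ B₂ K | T K
    data BComp : Set c where
      cKB   : Cont → CVal → BComp
      cBBK  : CVal → CVal → Cont → BComp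
      cTK   : SComb → Cont → BComp

    -- continuations  K ::= k | λb.B b K | λb₁.T(λb₂.b₁ b₂ K)
    data Cont : Set c where
      kvar : Cont
      kB   : CVal → Cont → Cont
      kT   : SComb → Cont → Cont

  -- Embedding of CPS syntax into (de Bruijn) terms.  The context
  -- records the kinds of the enclosing binders.
  data Kind : Set where
    ordK : Kind
    kK   : Kind
    bK   : Kind

  ordIdx : List Kind → ℕ → ℕ
  ordIdx [] x = x
  ordIdx (ordK ∷ Γ) zero = zero
  ordIdx (ordK ∷ Γ) (suc x) = suc (ordIdx Γ x)
  ordIdx (kK ∷ Γ) x = suc (ordIdx Γ x)
  ordIdx (bK ∷ Γ) x = suc (ordIdx Γ x)

  kIdx : List Kind → ℕ
  kIdx [] = zero
  kIdx (kK ∷ Γ) = zero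
  kIdx (ordK ∷ Γ) = suc (kIdx Γ)
  kIdx (bK ∷ Γ) = suc (kIdx Γ)

  mutual
    ⌜_⌝V : CVal → List Kind → Term
    ⌜ cvar x ⌝V Γ = var (ordIdx Γ x)
    ⌜ clam S ⌝V Γ = lam (⌜ S ⌝S (ordK ∷ Γ))

    ⌜_⌝S : Susp → List Kind → Term
    ⌜ slam C ⌝S Γ = lam (⌜ C ⌝C (kK ∷ Γ))

    ⌜_⌝T : SComb → List Kind → Term
    ⌜ sus S ⌝T Γ = ⌜ S ⌝S Γ
    ⌜ szer ⌝T Γ = zer
    ⌜ ssmul a T ⌝T Γ = smul a (⌜ T ⌝T Γ)
    ⌜ sadd T₁ T₂ ⌝T Γ = add (⌜ T₁ ⌝T Γ) (⌜ T₂ ⌝T Γ)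

    ⌜_⌝C : BComp → List Kind → Term
    ⌜ cKB K B ⌝C Γ = app (⌜ K ⌝K Γ) (⌜ B ⌝V Γ)
    ⌜ cBBK B₁ B₂ K ⌝C Γ = app (app (⌜ B₁ ⌝V Γ) (⌜ B₂ ⌝V Γ)) (⌜ K ⌝K Γ)
    ⌜ cTK T K ⌝C Γ = app (⌜ T ⌝T Γ) (⌜ K ⌝K Γ)

    ⌜_⌝K : Cont → List Kind → Term
    ⌜ kvar ⌝K Γ = var (kIdx Γ)
    ⌜ kB B K ⌝K Γ = lam (app (app (⌜ B ⌝V (bK ∷ Γ)) (var zero)) (⌜ K ⌝K (bK ∷ Γ)))
    ⌜ kT T K ⌝K Γ =
      lam (app (⌜ T ⌝T (bK ∷ Γ))
               (lam (app (app (var (suc zero)) (var zero)) (⌜ K ⌝K (bK ∷ bK ∷ Γ)))))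

  ⌜_⌝ : SComb → Term
  ⌜ T ⌝ = ⌜ T ⌝T []

  mutual
    ψ : CVal → Term
    ψ (cvar x) = var x
    ψ (clam S) = lam (σS S)

    σS : Susp → Term
    σS (slam C) = over C

    σ : SComb → Term
    σ (sus S) = σS S
    σ szer = zer
    σ (ssmul a T) = smul a (σ T)
    σ (sadd T₁ T₂) = add (σ T₁) (σ T₂)

    over : BComp → Term
    over (cKB K B) = fill K (ψ B)
    over (cBBK B₁ B₂ K) = fill K (app (ψ B₁) (ψ B₂))
    over (cTK T K) = fill K (σ T)

    fill : Cont → Term → Term
    fill kvar M = M
    fill (kB B K) M = fill K (app (ψ B) M)
    fill (kT T K) M = fill K (app M (σ T))

module Submission where

-- The embedding ⌜ T ⌝ of a suspension combination is a linear combination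
-- (built from 0, α._ and _+_) of λ-abstractions, and σ T is the same linear
-- combination with every leaf ⌜ S ⌝ replaced by σS S.  Since a linear
-- combination of abstractions is never an application, no (A)-rule and no
-- ξ-rule under an application can fire on ⌜ T ⌝, and →a cannot enter an
-- abstraction; so every step is an (L)-rule under ξ-contexts for 0, α._, _+_.
-- Those rules only inspect the linear skeleton, hence transfer to any other
-- choice of leaves, provided equal leaves are sent to equal leaves.

open import Defs
open import Algebra.Bundles using (Ring)
open import Data.Nat using (zero; suc)
open import Data.Nat.Properties using (suc-injective)
open import Data.List using (List; []; _∷_)
open import Data.Product using (Σ-syntax; _×_; _,_)
open import Data.Empty using (⊥; ⊥-elim)
open import Relation.Binary.PropositionalEquality using (_≡_; refl; sym; cong; cong₂)

module _ {c ℓ} (R : Ring c ℓ) where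
  open Lang R

  data Lin (Leaf : Term → Term → Set c) : Term → Term → Set c where
    lin-leaf : ∀ {t P} → Leaf t P → Lin Leaf (lam t) P
    lin-zer  : Lin Leaf zer zer
    lin-smul : ∀ {a M P} → Lin Leaf M P → Lin Leaf (smul a M) (smul a P)
    lin-add  : ∀ {M N P Q} → Lin Leaf M P → Lin Leaf N Q → Lin Leaf (add M N) (add P Q)

  module Transport (Leaf : Term → Term → Set c)
                   (leaf-functional : ∀ {t P Q} → Leaf t P → Leaf t Q → P ≡ Q) where

    -- Lin Leaf is functional: it is needed whenever an (L)-rule duplicates,
    -- erases or compares subterms.
    lin-functional : ∀ {M P Q} → Lin Leaf M P → Lin Leaf M Q → P ≡ Q
    lin-functional (lin-leaf l)   (lin-leaf l')    = leaf-functional l l'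
    lin-functional lin-zer        lin-zer          = refl
    lin-functional (lin-smul p)   (lin-smul q)     = cong (smul _) (lin-functional p q)
    lin-functional (lin-add p p') (lin-add q q')   =
      cong₂ add (lin-functional p q) (lin-functional p' q')

    transport-L : ∀ {M N P Q} → M →L N → Lin Leaf M P → Lin Leaf N Q → P →L Q
    transport-L L-assocˡ (lin-add p (lin-add p' p'')) (lin-add (lin-add q q') q'')
      rewrite lin-functional p q | lin-functional p' q' | lin-functional p'' q'' = L-assocˡ
    transport-L L-assocʳ (lin-add (lin-add p p') p'') (lin-add q (lin-add q' q''))
      rewrite lin-functional p q | lin-functional p' q' | lin-functional p'' q'' = L-assocʳ
    transport-L L-comm (lin-add p p') (lin-add q q')
      rewrite lin-functional p q' | lin-functional p' q = L-comm
    transport-L L-fact (lin-add (lin-smul p) (lin-smul p')) (lin-smul q)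
      rewrite lin-functional p q | lin-functional p' q = L-fact
    transport-L L-fact¹ (lin-add (lin-smul p) p') (lin-smul q)
      rewrite lin-functional p q | lin-functional p' q = L-fact¹
    transport-L L-fact² (lin-add p p') (lin-smul q)
      rewrite lin-functional p q | lin-functional p' q = L-fact²
    transport-L L-smul (lin-smul (lin-smul p)) (lin-smul q)
      rewrite lin-functional p q = L-smul
    transport-L L-dist (lin-smul (lin-add p p')) (lin-add (lin-smul q) (lin-smul q'))
      rewrite lin-functional p q | lin-functional p' q' = L-dist
    transport-L L-one (lin-smul p) q
      rewrite lin-functional p q = L-one
    transport-L L-zeroˢ (lin-smul p) lin-zer = L-zeroˢ
    transport-L L-zeroᵗ (lin-smul lin-zer) lin-zer = L-zeroᵗ
    transport-L L-zeroᵃ (lin-add lin-zer p) q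
      rewrite lin-functional p q = L-zeroᵃ

    -- Linear combinations of abstractions are not
    -- applications, so the (A)-rules and the ξ-rule for application are
    -- impossible; the remaining ξ-rules are mirrored by their →l versions.
    transport : ∀ {M N P Q} → M →a N → Lin Leaf M P → Lin Leaf N Q → P →l Q
    transport (a-A A-add) () _
    transport (a-A A-smul) () _
    transport (a-A A-zer) () _
    transport (a-L r) p q = l-L (transport-L r p q)
    transport (a-ξ-app s) () _
    transport (a-ξ-addˡ s) (lin-add p p') (lin-add q q')
      rewrite lin-functional p' q' = l-ξ-addˡ (transport s p q)
    transport (a-ξ-addʳ s) (lin-add p p') (lin-add q q')
      rewrite lin-functional p q = l-ξ-addʳ (transport s p' q')
    transport (a-ξ-smul s) (lin-smul p) (lin-smul q) = l-ξ-smul (transport s p q)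

  var-injective : ∀ {x y} → var x ≡ var y → x ≡ y
  var-injective refl = refl

  lam-injective : ∀ {M N} → lam M ≡ lam N → M ≡ N
  lam-injective refl = refl

  app-injectiveˡ : ∀ {M N M' N'} → app M N ≡ app M' N' → M ≡ M'
  app-injectiveˡ refl = refl

  app-injectiveʳ : ∀ {M N M' N'} → app M N ≡ app M' N' → N ≡ N'
  app-injectiveʳ refl = refl

  add-injectiveˡ : ∀ {M N M' N'} → add M N ≡ add M' N' → M ≡ M'
  add-injectiveˡ refl = refl

  add-injectiveʳ : ∀ {M N M' N'} → add M N ≡ add M' N' → N ≡ N'
  add-injectiveʳ refl = refl

  smul-injectiveˡ : ∀ {a b M N} → smul a M ≡ smul b N → a ≡ b
  smul-injectiveˡ refl = refl

  smul-injectiveʳ : ∀ {a b M N} → smul a M ≡ smul b N → M ≡ N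
  smul-injectiveʳ refl = refl

  ordIdx-injective : ∀ Γ {x y} → ordIdx Γ x ≡ ordIdx Γ y → x ≡ y
  ordIdx-injective []         e = e
  ordIdx-injective (ordK ∷ Γ) {zero}  {zero}  e = refl
  ordIdx-injective (ordK ∷ Γ) {suc x} {suc y} e = cong suc (ordIdx-injective Γ (suc-injective e))
  ordIdx-injective (kK ∷ Γ)   e = ordIdx-injective Γ (suc-injective e)
  ordIdx-injective (bK ∷ Γ)   e = ordIdx-injective Γ (suc-injective e)

  T-not-app : ∀ Γ T {M N} → ⌜ T ⌝T Γ ≡ app M N → ⊥
  T-not-app Γ (sus (slam C)) ()
  T-not-app Γ szer ()
  T-not-app Γ (ssmul a T) ()
  T-not-app Γ (sadd T₁ T₂) ()

  T-not-var : ∀ Γ T {x} → ⌜ T ⌝T Γ ≡ var x → ⊥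
  T-not-var Γ (sus (slam C)) ()
  T-not-var Γ szer ()
  T-not-var Γ (ssmul a T) ()
  T-not-var Γ (sadd T₁ T₂) ()

  K-not-app : ∀ Γ K {M N} → ⌜ K ⌝K Γ ≡ app M N → ⊥
  K-not-app Γ kvar ()
  K-not-app Γ (kB B K) ()
  K-not-app Γ (kT T K) ()

  -- The body of a suspension never looks like the body of λb.BbK: that would
  -- need a CPS-value encoded as the variable b, which is reserved.
  C-not-kB-body : ∀ Γ C {M N} → ⌜ C ⌝C (kK ∷ Γ) ≡ app (app M (var zero)) N → ⊥
  C-not-kB-body Γ (cKB K B) e = K-not-app (kK ∷ Γ) K (app-injectiveˡ e)
  C-not-kB-body Γ (cBBK B₁ (cvar x) K) ()
  C-not-kB-body Γ (cBBK B₁ (clam S) K) ()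
  C-not-kB-body Γ (cTK T K) e = T-not-app (kK ∷ Γ) T (app-injectiveˡ e)

  -- Likewise for the body of λb₁.T(λb₂.b₁b₂K): its argument would have to
  -- be a continuation applying the reserved variable b₁.
  C-not-kT-body : ∀ Γ C {M N} →
    ⌜ C ⌝C (kK ∷ Γ) ≡ app M (lam (app (app (var (suc zero)) (var zero)) N)) → ⊥
  C-not-kT-body Γ (cKB K (cvar x)) ()
  C-not-kT-body Γ (cKB K (clam (slam C))) ()
  C-not-kT-body Γ (cBBK B₁ B₂ kvar) ()
  C-not-kT-body Γ (cBBK B₁ B₂ (kB (cvar x) K)) ()
  C-not-kT-body Γ (cBBK B₁ B₂ (kB (clam S) K)) ()
  C-not-kT-body Γ (cBBK B₁ B₂ (kT T K)) e =
    T-not-app (bK ∷ kK ∷ Γ) T (app-injectiveˡ (lam-injective (app-injectiveʳ e)))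
  C-not-kT-body Γ (cTK T kvar) ()
  C-not-kT-body Γ (cTK T (kB (cvar x) K)) ()
  C-not-kT-body Γ (cTK T (kB (clam S) K)) ()
  C-not-kT-body Γ (cTK T (kT T' K)) e =
    T-not-app (bK ∷ kK ∷ Γ) T' (app-injectiveˡ (lam-injective (app-injectiveʳ e)))

  K-not-T : ∀ Γ K T → ⌜ K ⌝K Γ ≡ ⌜ T ⌝T Γ → ⊥
  K-not-T Γ kvar T e = T-not-var Γ T (sym e)
  K-not-T Γ (kB B K) (sus (slam C)) e = C-not-kB-body Γ C (sym (lam-injective e))
  K-not-T Γ (kT T' K) (sus (slam C)) e = C-not-kT-body Γ C (sym (lam-injective e))
  K-not-T Γ (kB B K) szer ()
  K-not-T Γ (kB B K) (ssmul a T) ()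
  K-not-T Γ (kB B K) (sadd T₁ T₂) ()
  K-not-T Γ (kT T' K) szer ()
  K-not-T Γ (kT T' K) (ssmul a T) ()
  K-not-T Γ (kT T' K) (sadd T₁ T₂) ()

  mutual
    ⌜⌝V-injective : ∀ Γ B B' → ⌜ B ⌝V Γ ≡ ⌜ B' ⌝V Γ → B ≡ B'
    ⌜⌝V-injective Γ (cvar x) (cvar y) e = cong cvar (ordIdx-injective Γ (var-injective e))
    ⌜⌝V-injective Γ (cvar x) (clam S) ()
    ⌜⌝V-injective Γ (clam S) (cvar x) ()
    ⌜⌝V-injective Γ (clam S) (clam S') e =
      cong clam (⌜⌝S-injective (ordK ∷ Γ) S S' (lam-injective e))

    ⌜⌝S-injective : ∀ Γ S S' → ⌜ S ⌝S Γ ≡ ⌜ S' ⌝S Γ → S ≡ S'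
    ⌜⌝S-injective Γ (slam C) (slam C') e =
      cong slam (⌜⌝C-injective (kK ∷ Γ) C C' (lam-injective e))

    ⌜⌝T-injective : ∀ Γ T T' → ⌜ T ⌝T Γ ≡ ⌜ T' ⌝T Γ → T ≡ T'
    ⌜⌝T-injective Γ (sus S) (sus S') e = cong sus (⌜⌝S-injective Γ S S' e)
    ⌜⌝T-injective Γ szer szer e = refl
    ⌜⌝T-injective Γ (ssmul a T) (ssmul b T') e =
      cong₂ ssmul (smul-injectiveˡ e) (⌜⌝T-injective Γ T T' (smul-injectiveʳ e))
    ⌜⌝T-injective Γ (sadd T₁ T₂) (sadd T₁' T₂') e =
      cong₂ sadd (⌜⌝T-injective Γ T₁ T₁' (add-injectiveˡ e))
                 (⌜⌝T-injective Γ T₂ T₂' (add-injectiveʳ e))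
    ⌜⌝T-injective Γ (sus (slam C)) szer ()
    ⌜⌝T-injective Γ (sus (slam C)) (ssmul b T') ()
    ⌜⌝T-injective Γ (sus (slam C)) (sadd T₁' T₂') ()
    ⌜⌝T-injective Γ szer (sus (slam C')) ()
    ⌜⌝T-injective Γ szer (ssmul b T') ()
    ⌜⌝T-injective Γ szer (sadd T₁' T₂') ()
    ⌜⌝T-injective Γ (ssmul a T) (sus (slam C')) ()
    ⌜⌝T-injective Γ (ssmul a T) szer ()
    ⌜⌝T-injective Γ (ssmul a T) (sadd T₁' T₂') ()
    ⌜⌝T-injective Γ (sadd T₁ T₂) (sus (slam C')) ()
    ⌜⌝T-injective Γ (sadd T₁ T₂) szer ()
    ⌜⌝T-injective Γ (sadd T₁ T₂) (ssmul b T') ()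

    ⌜⌝C-injective : ∀ Γ C C' → ⌜ C ⌝C Γ ≡ ⌜ C' ⌝C Γ → C ≡ C'
    ⌜⌝C-injective Γ (cKB K B) (cKB K' B') e =
      cong₂ cKB (⌜⌝K-injective Γ K K' (app-injectiveˡ e)) (⌜⌝V-injective Γ B B' (app-injectiveʳ e))
    ⌜⌝C-injective Γ (cBBK B₁ B₂ K) (cBBK B₁' B₂' K') e
      with ⌜⌝V-injective Γ B₁ B₁' (app-injectiveˡ (app-injectiveˡ e))
         | ⌜⌝V-injective Γ B₂ B₂' (app-injectiveʳ (app-injectiveˡ e))
         | ⌜⌝K-injective Γ K K' (app-injectiveʳ e)
    ... | refl | refl | refl = refl
    ⌜⌝C-injective Γ (cTK T K) (cTK T' K') e =
      cong₂ cTK (⌜⌝T-injective Γ T T' (app-injectiveˡ e)) (⌜⌝K-injective Γ K K' (app-injectiveʳ e))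
    ⌜⌝C-injective Γ (cKB K B) (cBBK B₁' B₂' K') e = ⊥-elim (K-not-app Γ K (app-injectiveˡ e))
    ⌜⌝C-injective Γ (cKB K B) (cTK T' K') e = ⊥-elim (K-not-T Γ K T' (app-injectiveˡ e))
    ⌜⌝C-injective Γ (cBBK B₁ B₂ K) (cKB K' B') e =
      ⊥-elim (K-not-app Γ K' (sym (app-injectiveˡ e)))
    ⌜⌝C-injective Γ (cBBK B₁ B₂ K) (cTK T' K') e =
      ⊥-elim (T-not-app Γ T' (sym (app-injectiveˡ e)))
    ⌜⌝C-injective Γ (cTK T K) (cKB K' B') e = ⊥-elim (K-not-T Γ K' T (sym (app-injectiveˡ e)))
    ⌜⌝C-injective Γ (cTK T K) (cBBK B₁' B₂' K') e = ⊥-elim (T-not-app Γ T (app-injectiveˡ e))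

    ⌜⌝K-injective : ∀ Γ K K' → ⌜ K ⌝K Γ ≡ ⌜ K' ⌝K Γ → K ≡ K'
    ⌜⌝K-injective Γ kvar kvar e = refl
    ⌜⌝K-injective Γ (kB B K) (kB B' K') e =
      cong₂ kB (⌜⌝V-injective (bK ∷ Γ) B B' (app-injectiveˡ (app-injectiveˡ (lam-injective e))))
               (⌜⌝K-injective (bK ∷ Γ) K K' (app-injectiveʳ (lam-injective e)))
    ⌜⌝K-injective Γ (kT T K) (kT T' K') e =
      cong₂ kT (⌜⌝T-injective (bK ∷ Γ) T T' (app-injectiveˡ (lam-injective e)))
               (⌜⌝K-injective (bK ∷ bK ∷ Γ) K K'
                 (app-injectiveʳ (lam-injective (app-injectiveʳ (lam-injective e)))))
    ⌜⌝K-injective Γ kvar (kB B' K') ()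
    ⌜⌝K-injective Γ kvar (kT T' K') ()
    ⌜⌝K-injective Γ (kB B K) kvar ()
    ⌜⌝K-injective Γ (kB B K) (kT T' K') e =
      ⊥-elim (T-not-app (bK ∷ Γ) T' (sym (app-injectiveˡ (lam-injective e))))
    ⌜⌝K-injective Γ (kT T K) kvar ()
    ⌜⌝K-injective Γ (kT T K) (kB B' K') e =
      ⊥-elim (T-not-app (bK ∷ Γ) T (app-injectiveˡ (lam-injective e)))

  Decodes : Term → Term → Set c
  Decodes t P = Σ[ C ∈ BComp ] (t ≡ ⌜ C ⌝C (kK ∷ [])) × (P ≡ over C)

  decodes-functional : ∀ {t P Q} → Decodes t P → Decodes t Q → P ≡ Q
  decodes-functional (C , refl , refl) (C' , e , refl) =
    cong over (⌜⌝C-injective (kK ∷ []) C C' e)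

  embedding-decodes : ∀ T → Lin Decodes ⌜ T ⌝ (σ T)
  embedding-decodes (sus (slam C)) = lin-leaf (C , refl , refl)
  embedding-decodes szer           = lin-zer
  embedding-decodes (ssmul a T)    = lin-smul (embedding-decodes T)
  embedding-decodes (sadd T₁ T₂)   = lin-add (embedding-decodes T₁) (embedding-decodes T₂)

lemma3p13 : ∀ {c ℓ} (R : Ring c ℓ) → let open Lang R in
    (T T' : SComb) → ⌜ T ⌝ →a ⌜ T' ⌝ → σ T →l σ T'
lemma3p13 R T T' step =
  Transport.transport R (Decodes R) (decodes-functional R)
    step (embedding-decodes R T) (embedding-decodes R T')
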